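{- Let $n\ge 2$. For all $a,b\in[n]$ with $a\ge b$, we have $|FC_a|\ge|FC_b|$.
   Context: Identify a monotone lattice path from $(0,0)$ to $(n-k,k)$ with the $k$-subset of $[n]$ of positions of its North steps. For $k$-subsets $U=\{u_1<\dots<u_k\}$, $L=\{\ell_1<\dots<\ell_k\}$ of $[n]$ with $u_i\le\ell_i$ for all $i$, the lattice path matroid $M[U,L]$ is the matroid on $[n]$ whose bases are the $k$-sets $\{b_1<\dots<b_k\}$ with $u_i\le b_i\le\ell_i$. $\mathcal{P}_n$ is the poset of all lattice path matroids on $[n]$ ordered by the matroid quotient relation ($M'\le_q M$ iff there is a matroid $N$ on $[n]\sqcup T$ with $M=N\setminus T$, $M'=N/T$). Known: $M[U',L']\le_q M[U,L]$ iff $U'\subseteq U$, $L'\subseteq L$ and the greedy pairing is good, where: $(\ell_i,u_j)$ is a good pair of $M[U,L]$ if $i\le j$ and $u_j-\ell_i\le j-i$; with $U\setminus U'=\{a_1<\dots<a_z\}$, $L\setminus L'=\{b_1<\dots<b_z\}$, the greedy pairing $((b_1,a_1),\dots,(b_z,a_z))$ is good if each $(b_r,a_r)$ is a good pair of $M[U\setminus\{a_1,\dots,a_{r-1}\},L\setminus\{b_1,\dots,b_{r-1}\}]$. Covers $M[U\setminus\{u\},L\setminus\{\ell\}]\lessdot M[U,L]$ are labeled $(\ell,u)$. A saturated chain $x_0\lessdot\cdots\lessdot x_m$ with labels $(\ell_i,u_i)=\lambda(x_{i-1}\lessdot x_i)$ is falling if for each $1\le i<m$ it is not the case that both $\ell_i<\ell_{i+1}$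 and $u_i<u_{i+1}$. Let $U_{0,n}=M[\emptyset,\emptyset]$ and for $k\in[n]$ let $M_{k,1}=M[[n]\setminus\{k\},[n]\setminus\{1\}]$ (rank $n-1$). $FC_k$ is the set of falling maximal chains of the interval $[U_{0,n},M_{k,1}]$ of $\mathcal{P}_n$. -}

module Defs where

open import Data.Nat using (ℕ; zero; suc; _+_; _≤ᵇ_; _<ᵇ_; _≡ᵇ_)
open import Data.Bool using (Bool; true; false; _∧_; _∨_; not; T; if_then_else_)
open import Data.List using (List; []; _∷_; map; _++_; concatMap; upTo)
open import Data.Product using (_×_; _,_; Σ)

-- Finite subsets of [n] = {1,…,n} are represented by strictly increasing
-- lists of naturals with entries in [n].

elem : ℕ → List ℕ → Bool
elem x [] = false
elem x (y ∷ ys) = (x ≡ᵇ y) ∨ elem x ys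

minus : List ℕ → List ℕ → List ℕ
minus [] ys = []
minus (x ∷ xs) ys = if elem x ys then minus xs ys else x ∷ minus xs ys

remove : ℕ → List ℕ → List ℕ
remove x xs = minus xs (x ∷ [])

subsetᵇ : List ℕ → List ℕ → Bool
subsetᵇ [] ys = true
subsetᵇ (x ∷ xs) ys = elem x ys ∧ subsetᵇ xs ys

eqListᵇ : List ℕ → List ℕ → Bool
eqListᵇ [] [] = true
eqListᵇ (x ∷ xs) (y ∷ ys) = (x ≡ᵇ y) ∧ eqListᵇ xs ys
eqListᵇ _ _ = false

strictInc : List ℕ → Bool
strictInc [] = true
strictInc (x ∷ []) = true
strictInc (x ∷ y ∷ ys) = (x <ᵇ y) ∧ strictInc (y ∷ ys)

inRange : ℕ → List ℕ → Bool
inRange n [] = true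
inRange n (x ∷ xs) = (1 ≤ᵇ x) ∧ (x ≤ᵇ n) ∧ inRange n xs

pointwiseLe : List ℕ → List ℕ → Bool
pointwiseLe [] [] = true
pointwiseLe (u ∷ us) (l ∷ ls) = (u ≤ᵇ l) ∧ pointwiseLe us ls
pointwiseLe _ _ = false

range : ℕ → List ℕ
range n = map suc (upTo n)

-- A lattice path matroid M[U,L] is given by the pair (U , L).
LPM : Set
LPM = List ℕ × List ℕ

isLPM : ℕ → LPM → Bool
isLPM n (U , L) = strictInc U ∧ strictInc L ∧ inRange n U ∧ inRange n L ∧ pointwiseLe U L

eqLPM : LPM → LPM → Bool
eqLPM (U , L) (U' , L') = eqListᵇ U U' ∧ eqListᵇ L L'

-- 1-based position of x in a list
index : ℕ → List ℕ → ℕ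
index x [] = 0
index x (y ∷ ys) = if x ≡ᵇ y then 1 else suc (index x ys)

-- (ℓ , u) with ℓ = ℓ_i, u = u_j is a good pair of M[U,L]:
-- i ≤ j and u_j - ℓ_i ≤ j - i  (written u_j + i ≤ j + ℓ_i to stay in ℕ)
goodPair : LPM → ℕ → ℕ → Bool
goodPair (U , L) ℓ u =
  elem ℓ L ∧ elem u U ∧ (index ℓ L ≤ᵇ index u U)
    ∧ (u + index ℓ L ≤ᵇ index u U + ℓ)

greedyGood : LPM → List ℕ → List ℕ → Bool
greedyGood M [] [] = true
greedyGood (U , L) (a ∷ as) (b ∷ bs) =
  goodPair (U , L) b a ∧ greedyGood (remove a U , remove b L) as bs
greedyGood M _ _ = false

-- M[U',L'] ≤_q M[U,L]  (the known characterization of the quotient order)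
leqQ : LPM → LPM → Bool
leqQ (U' , L') (U , L) =
  subsetᵇ U' U ∧ subsetᵇ L' L ∧ greedyGood (U , L) (minus U U') (minus L L')

ltQ : LPM → LPM → Bool
ltQ x y = leqQ x y ∧ not (eqLPM x y)

subsets : List ℕ → List (List ℕ)
subsets [] = [] ∷ []
subsets (x ∷ xs) = map (x ∷_) (subsets xs) ++ subsets xs

filterᵇ : {A : Set} → (A → Bool) → List A → List A
filterᵇ p [] = []
filterᵇ p (x ∷ xs) = if p x then x ∷ filterᵇ p xs else filterᵇ p xs

allLPM : ℕ → List LPM
allLPM n = filterᵇ (isLPM n)
  (concatMap (λ U → map (λ L → (U , L)) (subsets (range n))) (subsets (range n)))

anyᵇ : {A : Set} → (A → Bool) → List A → Bool
anyᵇ p [] = false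
anyᵇ p (x ∷ xs) = p x ∨ anyᵇ p xs

cover : ℕ → LPM → LPM → Bool
cover n x y = isLPM n x ∧ isLPM n y ∧ ltQ x y
  ∧ not (anyᵇ (λ z → ltQ x z ∧ ltQ z y) (allLPM n))

-- U_{0,n} = M[∅,∅]
bottom : LPM
bottom = ([] , [])

-- M_{k,1} = M[[n]∖{k}, [n]∖{1}]
topM : ℕ → ℕ → LPM
topM n k = (remove k (range n) , remove 1 (range n))

headIs : LPM → List LPM → Bool
headIs x [] = false
headIs x (y ∷ _) = eqLPM x y

lastIs : LPM → List LPM → Bool
lastIs x [] = false
lastIs x (y ∷ []) = eqLPM x y
lastIs x (_ ∷ y ∷ ys) = lastIs x (y ∷ ys)

coverChain : ℕ → List LPM → Bool
coverChain n [] = false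
coverChain n (x ∷ []) = isLPM n x
coverChain n (x ∷ y ∷ r) = cover n x y ∧ coverChain n (y ∷ r)

-- chain x_0 ⋖ x_1 ⋖ ⋯ ⋖ x_m (listed bottom first) is a maximal chain of
-- the interval [U_{0,n}, M_{k,1}]
isMaxChain : ℕ → ℕ → List LPM → Bool
isMaxChain n k c = headIs bottom c ∧ lastIs (topM n k) c ∧ coverChain n c

headD : List ℕ → ℕ
headD [] = 0
headD (x ∷ _) = x

-- label (ℓ , u) of the cover x ⋖ y where x = M[U∖{u}, L∖{ℓ}], y = M[U,L]
label : LPM → LPM → ℕ × ℕ
label (U' , L') (U , L) = (headD (minus L L') , headD (minus U U'))

labels : List LPM → List (ℕ × ℕ)
labels [] = []
labels (x ∷ []) = []
labels (x ∷ y ∷ r) = label x y ∷ labels (y ∷ r)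

fallingLabels : List (ℕ × ℕ) → Bool
fallingLabels [] = true
fallingLabels (p ∷ []) = true
fallingLabels ((l , u) ∷ (l' , u') ∷ r) =
  not ((l <ᵇ l') ∧ (u <ᵇ u')) ∧ fallingLabels ((l' , u') ∷ r)

FC : ℕ → ℕ → Set
FC n k = Σ (List LPM) (λ c → T (isMaxChain n k c ∧ fallingLabels (labels c)))

{-# OPTIONS --safe #-}

-- Let f be the increasing bijection [n]∖{b} → [n]∖{a} that moves b + 1, …, a down by one and
-- fixes everything else, so f x ≤ x. A cover M[U∖{u}, L∖{ℓ}] ⋖ M[U,L] in 𝒫ₙ is exactly the
-- deletion of a good pair (ℓ,u): a good greedy pairing with two or more pairs is not a cover,
-- since deleting its first pair gives a lattice path matroid strictly in between. Replacing U
-- by f(U) keeps the position of every entry of U and lowers it, so it preserves lattice path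
-- matroids and good pairs, hence covers, and turns the label (ℓ,u) into (ℓ, f u). Every U in a
-- chain of [U_{0,n}, M_{b,1}] avoids b, so applying f to all of them maps the maximal chains of
-- [U_{0,n}, M_{b,1}] injectively to those of [U_{0,n}, M_{a,1}], and as f is monotone, falling
-- chains stay falling.

module Submission where

open import Defs
open import Data.Bool using (Bool; true; false; T; T?; _∧_)
open import Data.Bool.Properties using (T-irrelevant)
open import Data.Empty using (⊥-elim)
open import Data.List using (List; []; _∷_; [_]; length; map; filter; concatMap)
open import Data.List.Properties using (filter-reject; filter-all; ∷-injective)
open import Data.List.Membership.Propositional using (_∈_; _∉_; find; lose)
open import Data.List.Membership.Propositional.Properties
  using (∈-map⁺; ∈-map⁻; ∈-upTo⁺; ∈-upTo⁻; ∈-filter⁺; ∈-filter⁻; ∈-++⁺ˡ; ∈-++⁺ʳ; ∈-concatMap⁺)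
open import Data.List.Relation.Binary.Pointwise as Pointwise using (Pointwise; []; _∷_)
open import Data.List.Relation.Binary.Sublist.Propositional using ([]; _∷_; _∷ʳ_) renaming (_⊆_ to _⊑_)
open import Data.List.Relation.Binary.Subset.Propositional using (_⊆_)
open import Data.List.Relation.Binary.Subset.Propositional.Properties as Subsetₚ
  using (∈-∷⁺ʳ; ⊆-refl; ⊆-reflexive; ⊆-trans; ⊆∷∧∉⇒⊆; ⊆[]⇒≡[])
open import Data.List.Relation.Unary.All as All using (All; []; _∷_)
open import Data.List.Relation.Unary.Any as Any using (Any; here; there)
open import Data.List.Relation.Unary.Linked as Linked using (Linked; []; [-]; _∷_)
open import Data.List.Relation.Unary.Linked.Properties as Linkedₚ using (Linked⇒All)
open import Data.Nat using (ℕ; suc; pred; _+_; _≤_; _<_; _≡ᵇ_; s≤s; s≤s⁻¹; z≤n)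
open import Data.Nat.Properties
open import Data.List.Membership.DecPropositional _≟_ using (_∈?_; _∉?_)
open import Data.Product using (_×_; _,_; ∃; proj₁; proj₂; uncurry; map₂)
open import Data.Product.Properties using (×-≡,≡→≡; ×-≡,≡←≡)
open import Data.Sum using (_⊎_; inj₁; inj₂)
open import Function using (_∘_; const; case_of_)
open import Function.Bundles using (_↣_; _⇔_; mk⇔; mk↣; Equivalence)
open import Relation.Binary.Definitions using (tri<; tri≈; tri>)
open import Relation.Binary.PropositionalEquality
  using (_≡_; _≢_; refl; sym; trans; cong; cong₂; subst; subst₂; module ≡-Reasoning)
open import Relation.Nullary using (¬_; does; proof; yes; no)
open import Relation.Nullary.Decidable using (dec-true; dec-false)
open import Relation.Nullary.Reflects
  using (Reflects; ofʸ; ofⁿ; _×-reflects_; _⊎-reflects_; ¬-reflects; T-reflects; det)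

private
  variable
    A B : Set
    β : Bool
    n w x y : ℕ
    xs ys : List ℕ

reflects-map : Reflects A β → (A → B) → (B → A) → Reflects B β
reflects-map (ofʸ a) f g = ofʸ (f a)
reflects-map (ofⁿ ¬a) f g = ofⁿ (¬a ∘ g)

reflects⇒T⇔ : Reflects A β → T β ⇔ A
reflects⇒T⇔ (ofʸ a) = mk⇔ (const a) (const _)
reflects⇒T⇔ (ofⁿ ¬a) = mk⇔ (λ ()) ¬a

-- Increasing lists as finite sets

Increasing : List ℕ → Set
Increasing = Linked _<_

increasing-head : Increasing (x ∷ xs) → All (x <_) xs
increasing-head [-] = []
increasing-head (x<y ∷ l) = Linked⇒All <-trans x<y l

increasing-head∉ : Increasing (x ∷ xs) → x ∉ xs
increasing-head∉ ixs x∈xs = <-irrefl refl (All.lookup (increasing-head ixs) x∈xs)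

increasing-head≤ : Increasing (x ∷ xs) → w ∈ x ∷ xs → x ≤ w
increasing-head≤ ixs (here refl) = ≤-refl
increasing-head≤ ixs (there w∈xs) = <⇒≤ (All.lookup (increasing-head ixs) w∈xs)

increasing-heads-≡ : Increasing (x ∷ xs) → Increasing (y ∷ ys) →
                     x ∷ xs ⊆ y ∷ ys → y ∷ ys ⊆ x ∷ xs → x ≡ y
increasing-heads-≡ ixs iys xs⊆ ys⊆ with xs⊆ (here refl)
... | here x≡y = x≡y
... | there x∈ys = ⊥-elim (<⇒≱ (All.lookup (increasing-head iys) x∈ys)
                               (increasing-head≤ ixs (ys⊆ (here refl))))

increasing-⊆-antisym : Increasing xs → Increasing ys → xs ⊆ ys → ys ⊆ xs → xs ≡ ys
increasing-⊆-antisym {[]} {[]} _ _ _ _ = refl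
increasing-⊆-antisym {[]} {y ∷ ys} _ _ _ ys⊆ with () ← ys⊆ (here refl)
increasing-⊆-antisym {x ∷ xs} {[]} _ _ xs⊆ _ with () ← xs⊆ (here refl)
increasing-⊆-antisym {x ∷ xs} {y ∷ ys} ixs iys xs⊆ ys⊆
  with refl ← increasing-heads-≡ ixs iys xs⊆ ys⊆ =
  cong (x ∷_) (increasing-⊆-antisym (Linked.tail ixs) (Linked.tail iys)
                (⊆∷∧∉⇒⊆ (xs⊆ ∘ there) (increasing-head∉ ixs))
                (⊆∷∧∉⇒⊆ (ys⊆ ∘ there) (increasing-head∉ iys)))

increasing-⊆⇒⊑ : Increasing xs → Increasing ys → xs ⊆ ys → xs ⊑ ys
increasing-⊆⇒⊑ {[]} {[]} _ _ _ = []
increasing-⊆⇒⊑ {[]} {y ∷ ys} _ iys _ = y ∷ʳ increasing-⊆⇒⊑ [] (Linked.tail iys) λ ()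
increasing-⊆⇒⊑ {x ∷ xs} {[]} _ _ xs⊆ with () ← xs⊆ (here refl)
increasing-⊆⇒⊑ {x ∷ xs} {y ∷ ys} ixs iys xs⊆ with xs⊆ (here refl)
... | here refl = refl ∷ increasing-⊆⇒⊑ (Linked.tail ixs) (Linked.tail iys)
                                 (⊆∷∧∉⇒⊆ (xs⊆ ∘ there) (increasing-head∉ ixs))
... | there x∈ys = y ∷ʳ increasing-⊆⇒⊑ ixs (Linked.tail iys) (⊆∷∧∉⇒⊆ xs⊆ y∉x∷xs)
  where
  y∉x∷xs : y ∉ x ∷ xs
  y∉x∷xs y∈ = <⇒≱ (All.lookup (increasing-head iys) x∈ys) (increasing-head≤ ixs y∈)

⊑⇒∈subsets : xs ⊑ ys → xs ∈ subsets ys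
⊑⇒∈subsets [] = here refl
⊑⇒∈subsets (y ∷ʳ xs⊑ys) = ∈-++⁺ʳ _ (⊑⇒∈subsets xs⊑ys)
⊑⇒∈subsets {y ∷ xs} (refl ∷ xs⊑ys) = ∈-++⁺ˡ (∈-map⁺ (y ∷_) (⊑⇒∈subsets xs⊑ys))

∈-range⁺ : 1 ≤ w → w ≤ n → w ∈ range n
∈-range⁺ {suc w} _ w<n = ∈-map⁺ suc (∈-upTo⁺ w<n)

∈-range⁻ : w ∈ range n → 1 ≤ w × w ≤ n
∈-range⁻ w∈ with _ , v∈ , refl ← ∈-map⁻ suc w∈ = s≤s z≤n , ∈-upTo⁻ v∈

range-increasing : ∀ n → Increasing (range n)
range-increasing n = Linkedₚ.map⁺ (Linkedₚ.applyUpTo⁺₂ _ n (λ i → n<1+n (suc i)))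

elem-reflects : ∀ x xs → Reflects (x ∈ xs) (elem x xs)
elem-reflects x [] = ofⁿ λ ()
elem-reflects x (y ∷ ys) =
  reflects-map (proof (x ≟ y) ⊎-reflects elem-reflects x ys) Any.fromSum Any.toSum

minus≡filter : ∀ xs ys → minus xs ys ≡ filter (_∉? ys) xs
minus≡filter [] ys = refl
minus≡filter (x ∷ xs) ys rewrite det (elem-reflects x ys) (proof (x ∈? ys)) with does (x ∈? ys)
... | true = minus≡filter xs ys
... | false = cong (x ∷_) (minus≡filter xs ys)

∈-minus⁺ : w ∈ xs → w ∉ ys → w ∈ minus xs ys
∈-minus⁺ {xs = xs} {ys} w∈xs w∉ys =
  subst (_ ∈_) (sym (minus≡filter xs ys)) (∈-filter⁺ (_∉? ys) w∈xs w∉ys)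

∈-minus⁻ : ∀ xs ys → w ∈ minus xs ys → w ∈ xs × w ∉ ys
∈-minus⁻ xs ys = ∈-filter⁻ (_∉? ys) ∘ subst (_ ∈_) (minus≡filter xs ys)

minus-increasing : ∀ ys → Increasing xs → Increasing (minus xs ys)
minus-increasing {xs} ys =
  subst Increasing (sym (minus≡filter xs ys)) ∘ Linkedₚ.filter⁺ (_∉? ys) <-trans

minus-self : ∀ xs → minus xs xs ≡ []
minus-self xs = ⊆[]⇒≡[] λ w∈ → let w∈xs , w∉xs = ∈-minus⁻ xs xs w∈ in ⊥-elim (w∉xs w∈xs)

minus≡[]⇒⊆ : minus xs ys ≡ [] → xs ⊆ ys
minus≡[]⇒⊆ {ys = ys} xs∖ys≡[] {w} w∈xs with w ∈? ys
... | yes w∈ys = w∈ys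
... | no w∉ys with () ← subst (w ∈_) xs∖ys≡[] (∈-minus⁺ w∈xs w∉ys)

∈-minus-[_] : ∀ u → minus xs ys ≡ [ u ] → w ∈ xs → w ∉ ys → w ≡ u
∈-minus-[ u ] xs∖ys≡[u] w∈xs w∉ys
  with here w≡u ← subst (_ ∈_) xs∖ys≡[u] (∈-minus⁺ w∈xs w∉ys) = w≡u

between-minus-[_] : ∀ u {X Z Y} → Increasing X → Increasing Z → Increasing Y →
                    X ⊆ Z → Z ⊆ Y → minus Y X ≡ [ u ] → Z ≡ Y ⊎ Z ≡ X
between-minus-[ u ] {X} {Z} {Y} iX iZ iY X⊆Z Z⊆Y Y∖X≡[u] with u ∈? Z
... | yes u∈Z = inj₁ (increasing-⊆-antisym iZ iY Z⊆Y Y⊆Z)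
  where
  Y⊆Z : Y ⊆ Z
  Y⊆Z {w} w∈Y with w ∈? X
  ... | yes w∈X = X⊆Z w∈X
  ... | no w∉X with refl ← ∈-minus-[ u ] Y∖X≡[u] w∈Y w∉X = u∈Z
... | no u∉Z = inj₂ (increasing-⊆-antisym iZ iX Z⊆X X⊆Z)
  where
  Z⊆X : Z ⊆ X
  Z⊆X {w} w∈Z with w ∈? X
  ... | yes w∈X = w∈X
  ... | no w∉X with refl ← ∈-minus-[ u ] Y∖X≡[u] (Z⊆Y w∈Z) w∉X = ⊥-elim (u∉Z w∈Z)

∈-remove⁺ : w ∈ xs → w ≢ x → w ∈ remove x xs
∈-remove⁺ w∈xs w≢x = ∈-minus⁺ w∈xs λ { (here w≡x) → w≢x w≡x }

∈-remove⁻ : ∀ x xs → w ∈ remove x xs → w ∈ xs × w ≢ x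
∈-remove⁻ x xs w∈ = let w∈xs , w∉[x] = ∈-minus⁻ xs [ x ] w∈ in w∈xs , w∉[x] ∘ here

remove-⊆ : ∀ x xs → remove x xs ⊆ xs
remove-⊆ x xs = proj₁ ∘ ∈-remove⁻ x xs

remove-head : Increasing (x ∷ xs) → remove x (x ∷ xs) ≡ xs
remove-head {x} {xs} ixs = begin
  remove x (x ∷ xs)            ≡⟨ minus≡filter (x ∷ xs) [ x ] ⟩
  filter (_∉? [ x ]) (x ∷ xs)  ≡⟨ filter-reject (_∉? [ x ]) (λ x∉[x] → x∉[x] (here refl)) ⟩
  filter (_∉? [ x ]) xs        ≡⟨ filter-all (_∉? [ x ]) (All.map x<⇒∉[x] (increasing-head ixs)) ⟩
  xs                           ∎
  where
  open ≡-Reasoning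
  x<⇒∉[x] : x < w → w ∉ [ x ]
  x<⇒∉[x] x<w (here refl) = <-irrefl refl x<w

remove-∷ : y ≢ x → remove x (y ∷ xs) ≡ y ∷ remove x xs
remove-∷ {y} {x} y≢x rewrite dec-false (y ≟ x) y≢x = refl

minus-remove-self : ∀ {u Y} → Increasing Y → u ∈ Y → minus Y (remove u Y) ≡ [ u ]
minus-remove-self {u} {Y} iY u∈Y = increasing-⊆-antisym (minus-increasing _ iY) [-] ⊆[u] [u]⊆
  where
  ⊆[u] : minus Y (remove u Y) ⊆ [ u ]
  ⊆[u] {w} w∈ with w ≟ u | ∈-minus⁻ Y _ w∈
  ... | yes refl | _ = here refl
  ... | no w≢u | w∈Y , w∉ = ⊥-elim (w∉ (∈-remove⁺ w∈Y w≢u))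
  [u]⊆ : [ u ] ⊆ minus Y (remove u Y)
  [u]⊆ (here refl) = ∈-minus⁺ u∈Y λ u∈ → proj₂ (∈-remove⁻ u Y u∈) refl

minus-remove-head : ∀ {X Y u us} → Increasing Y → minus Y X ≡ u ∷ us → minus (remove u Y) X ≡ us
minus-remove-head {X} {Y} {u} {us} iY Y∖X≡ =
  increasing-⊆-antisym (minus-increasing X (minus-increasing _ iY)) (Linked.tail iu∷us) ⊆us us⊆
  where
  iu∷us : Increasing (u ∷ us)
  iu∷us = subst Increasing Y∖X≡ (minus-increasing X iY)
  ⊆us : minus (remove u Y) X ⊆ us
  ⊆us w∈ with w∈uY , w∉X ← ∈-minus⁻ (remove u Y) X w∈ with w∈Y , w≢u ← ∈-remove⁻ u Y w∈uY
    with subst (_ ∈_) Y∖X≡ (∈-minus⁺ w∈Y w∉X)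
  ... | here w≡u = ⊥-elim (w≢u w≡u)
  ... | there w∈us = w∈us
  us⊆ : us ⊆ minus (remove u Y) X
  us⊆ w∈us with w∈Y , w∉X ← ∈-minus⁻ Y X (subst (_ ∈_) (sym Y∖X≡) (there w∈us)) =
    ∈-minus⁺ (∈-remove⁺ w∈Y (λ { refl → increasing-head∉ iu∷us w∈us })) w∉X

index-head : ∀ x xs → index x (x ∷ xs) ≡ 1
index-head x xs rewrite dec-true (x ≟ x) refl = refl

index-∷ : ∀ {x y} ys → x ≢ y → index x (y ∷ ys) ≡ suc (index x ys)
index-∷ {x} {y} ys x≢y rewrite dec-false (x ≟ y) x≢y = refl

index-pos : x ∈ xs → 1 ≤ index x xs
index-pos {x} {y ∷ ys} x∈ with x ≟ y
... | yes refl rewrite index-head x ys = ≤-refl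
... | no x≢y rewrite index-∷ ys x≢y = s≤s z≤n

elem-map : ∀ (f : ℕ → ℕ) {y} X → (∀ {x} → x ∈ X → f y ≡ f x → y ≡ x) →
           elem (f y) (map f X) ≡ elem y X
elem-map f {y} X f-inj =
  det (elem-reflects (f y) (map f X)) (reflects-map (elem-reflects y X) (∈-map⁺ f) λ fy∈ →
    let x , x∈X , fy≡fx = ∈-map⁻ f fy∈ in subst (_∈ X) (sym (f-inj x∈X fy≡fx)) x∈X)

minus-map : ∀ (f : ℕ → ℕ) {X} Y → (∀ {x y} → x ∈ Y → y ∈ X → f x ≡ f y → x ≡ y) →
            minus (map f Y) (map f X) ≡ map f (minus Y X)
minus-map f [] f-inj = refl
minus-map f {X} (y ∷ Y) f-inj rewrite elem-map f X (f-inj (here refl)) with elem y X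
... | true = minus-map f Y (f-inj ∘ there)
... | false = cong (f y ∷_) (minus-map f Y (f-inj ∘ there))

map-injectiveOn : ∀ {C D : Set} (f : C → D) {P : C → Set} →
                  (∀ {c c'} → P c → P c' → f c ≡ f c' → c ≡ c') →
                  ∀ {cs cs'} → All P cs → All P cs' → map f cs ≡ map f cs' → cs ≡ cs'
map-injectiveOn f f-inj [] [] _ = refl
map-injectiveOn f f-inj (pc ∷ pcs) (pc' ∷ pcs') fcs≡fcs' =
  let fc≡fc' , map≡map = ∷-injective fcs≡fcs'
  in cong₂ _∷_ (f-inj pc pc' fc≡fc') (map-injectiveOn f f-inj pcs pcs' map≡map)

filterᵇ≡filter : ∀ {C : Set} (p : C → Bool) cs → filterᵇ p cs ≡ filter (T? ∘ p) cs
filterᵇ≡filter p [] = refl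
filterᵇ≡filter p (c ∷ cs) with p c
... | true = cong (c ∷_) (filterᵇ≡filter p cs)
... | false = filterᵇ≡filter p cs

-- Propositional form of the boolean definitions

subsetᵇ-reflects : ∀ xs ys → Reflects (xs ⊆ ys) (subsetᵇ xs ys)
subsetᵇ-reflects [] ys = ofʸ λ ()
subsetᵇ-reflects (x ∷ xs) ys =
  reflects-map (elem-reflects x ys ×-reflects subsetᵇ-reflects xs ys)
    (uncurry ∈-∷⁺ʳ) (λ x∷xs⊆ys → x∷xs⊆ys (here refl) , x∷xs⊆ys ∘ there)

eqListᵇ-reflects : ∀ xs ys → Reflects (xs ≡ ys) (eqListᵇ xs ys)
eqListᵇ-reflects [] [] = ofʸ refl
eqListᵇ-reflects [] (y ∷ ys) = ofⁿ λ ()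
eqListᵇ-reflects (x ∷ xs) [] = ofⁿ λ ()
eqListᵇ-reflects (x ∷ xs) (y ∷ ys) =
  reflects-map (proof (x ≟ y) ×-reflects eqListᵇ-reflects xs ys)
    (uncurry (cong₂ _∷_)) ∷-injective

strictInc-reflects : ∀ xs → Reflects (Increasing xs) (strictInc xs)
strictInc-reflects [] = ofʸ []
strictInc-reflects (x ∷ []) = ofʸ [-]
strictInc-reflects (x ∷ y ∷ ys) =
  reflects-map (<ᵇ-reflects-< x y ×-reflects strictInc-reflects (y ∷ ys))
    (uncurry _∷_) (λ l → Linked.head l , Linked.tail l)

inRange-reflects : ∀ n xs → Reflects (xs ⊆ range n) (inRange n xs)
inRange-reflects n [] = ofʸ λ ()
inRange-reflects n (x ∷ xs) =
  reflects-map (≤ᵇ-reflects-≤ 1 x ×-reflects ≤ᵇ-reflects-≤ x n ×-reflects inRange-reflects n xs)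
    (λ (1≤x , x≤n , xs⊆) → ∈-∷⁺ʳ (∈-range⁺ 1≤x x≤n) xs⊆)
    (λ x∷xs⊆ → let 1≤x , x≤n = ∈-range⁻ (x∷xs⊆ (here refl)) in 1≤x , x≤n , x∷xs⊆ ∘ there)

pointwiseLe-reflects : ∀ us ls → Reflects (Pointwise _≤_ us ls) (pointwiseLe us ls)
pointwiseLe-reflects [] [] = ofʸ []
pointwiseLe-reflects [] (l ∷ ls) = ofⁿ λ ()
pointwiseLe-reflects (u ∷ us) [] = ofⁿ λ ()
pointwiseLe-reflects (u ∷ us) (l ∷ ls) =
  reflects-map (≤ᵇ-reflects-≤ u l ×-reflects pointwiseLe-reflects us ls)
    (uncurry _∷_) Pointwise.uncons

IsLPM : ℕ → LPM → Set
IsLPM n (U , L) = Increasing U × Increasing L × U ⊆ range n × L ⊆ range n × Pointwise _≤_ U L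

isLPM-reflects : ∀ n M → Reflects (IsLPM n M) (isLPM n M)
isLPM-reflects n (U , L) =
  strictInc-reflects U ×-reflects strictInc-reflects L ×-reflects
  inRange-reflects n U ×-reflects inRange-reflects n L ×-reflects pointwiseLe-reflects U L

eqLPM-reflects : ∀ M N → Reflects (M ≡ N) (eqLPM M N)
eqLPM-reflects (U , L) (U' , L') =
  reflects-map (eqListᵇ-reflects U U' ×-reflects eqListᵇ-reflects L L') ×-≡,≡→≡ ×-≡,≡←≡

GoodPair : LPM → ℕ → ℕ → Set
GoodPair (U , L) ℓ u = ℓ ∈ L × u ∈ U × index ℓ L ≤ index u U × u + index ℓ L ≤ index u U + ℓ

goodPair-reflects : ∀ M ℓ u → Reflects (GoodPair M ℓ u) (goodPair M ℓ u)
goodPair-reflects (U , L) ℓ u =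
  elem-reflects ℓ L ×-reflects elem-reflects u U ×-reflects
  ≤ᵇ-reflects-≤ _ _ ×-reflects ≤ᵇ-reflects-≤ _ _

greedyGood-∷-reflects : ∀ U L a b as bs →
  Reflects (GoodPair (U , L) b a × T (greedyGood (remove a U , remove b L) as bs))
           (greedyGood (U , L) (a ∷ as) (b ∷ bs))
greedyGood-∷-reflects U L a b as bs = goodPair-reflects (U , L) b a ×-reflects T-reflects _

greedyGood-length : ∀ M as bs → T (greedyGood M as bs) → length as ≡ length bs
greedyGood-length M [] [] _ = refl
greedyGood-length (U , L) (a ∷ as) (b ∷ bs) g = cong suc (greedyGood-length _ as bs rest)
  where rest = proj₂ (Equivalence.to (reflects⇒T⇔ (greedyGood-∷-reflects U L a b as bs)) g)

_≤q_ : LPM → LPM → Set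
(U' , L') ≤q (U , L) = U' ⊆ U × L' ⊆ L × T (greedyGood (U , L) (minus U U') (minus L L'))

_<q_ : LPM → LPM → Set
N <q M = N ≤q M × N ≢ M

ltQ-reflects : ∀ N M → Reflects (N <q M) (ltQ N M)
ltQ-reflects (U' , L') (U , L) =
  (subsetᵇ-reflects U' U ×-reflects subsetᵇ-reflects L' L ×-reflects T-reflects _)
  ×-reflects ¬-reflects (eqLPM-reflects (U' , L') (U , L))

anyᵇ-reflects : ∀ {C : Set} {P : C → Set} {p} → (∀ c → Reflects (P c) (p c)) →
                ∀ cs → Reflects (Any P cs) (anyᵇ p cs)
anyᵇ-reflects P-reflects [] = ofⁿ λ ()
anyᵇ-reflects P-reflects (c ∷ cs) =
  reflects-map (P-reflects c ⊎-reflects anyᵇ-reflects P-reflects cs) Any.fromSum Any.toSum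

Cover : ℕ → LPM → LPM → Set
Cover n N M = IsLPM n N × IsLPM n M × N <q M × ¬ Any (λ K → N <q K × K <q M) (allLPM n)

cover-reflects : ∀ n N M → Reflects (Cover n N M) (cover n N M)
cover-reflects n N M =
  isLPM-reflects n N ×-reflects isLPM-reflects n M ×-reflects ltQ-reflects N M ×-reflects
  ¬-reflects (anyᵇ-reflects (λ K → ltQ-reflects N K ×-reflects ltQ-reflects K M) (allLPM n))

pairsOfSubsets : ℕ → List LPM
pairsOfSubsets n = concatMap (λ U → map (U ,_) (subsets (range n))) (subsets (range n))

allLPM≡filter : ∀ n → allLPM n ≡ filter (T? ∘ isLPM n) (pairsOfSubsets n)
allLPM≡filter n = filterᵇ≡filter (isLPM n) (pairsOfSubsets n)

isLPM⇒∈allLPM : ∀ {n M} → IsLPM n M → M ∈ allLPM n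
isLPM⇒∈allLPM {n} {U , L} isM@(iU , iL , U⊆ , L⊆ , _) =
  subst (_ ∈_) (sym (allLPM≡filter n))
    (∈-filter⁺ (T? ∘ isLPM n) (∈-concatMap⁺ (λ U → map (U ,_) (subsets (range n)))
                                 (Any.map (λ { refl → ∈-map⁺ (U ,_) L∈ }) U∈))
                              (Equivalence.from (reflects⇒T⇔ (isLPM-reflects n (U , L))) isM))
  where
  U∈ = ⊑⇒∈subsets (increasing-⊆⇒⊑ iU (range-increasing n) U⊆)
  L∈ = ⊑⇒∈subsets (increasing-⊆⇒⊑ iL (range-increasing n) L⊆)

∈allLPM⇒isLPM : ∀ {n M} → M ∈ allLPM n → IsLPM n M
∈allLPM⇒isLPM {n} {M} M∈ =
  Equivalence.to (reflects⇒T⇔ (isLPM-reflects n M))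
    (proj₂ (∈-filter⁻ (T? ∘ isLPM n) {xs = pairsOfSubsets n}
                      (subst (_ ∈_) (allLPM≡filter n) M∈)))

coverChain-∷⇔ : ∀ n M M' c →
  T (coverChain n (M ∷ M' ∷ c)) ⇔ (Cover n M M' × T (coverChain n (M' ∷ c)))
coverChain-∷⇔ n M M' c = reflects⇒T⇔ (cover-reflects n M M' ×-reflects T-reflects _)

NotRising : ℕ × ℕ → ℕ × ℕ → Set
NotRising (ℓ , u) (ℓ' , u') = ¬ (ℓ < ℓ' × u < u')

fallingLabels-reflects : ∀ ps → Reflects (Linked NotRising ps) (fallingLabels ps)
fallingLabels-reflects [] = ofʸ []
fallingLabels-reflects (p ∷ []) = ofʸ [-]
fallingLabels-reflects ((ℓ , u) ∷ (ℓ' , u') ∷ ps) =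
  reflects-map (¬-reflects (<ᵇ-reflects-< ℓ ℓ' ×-reflects <ᵇ-reflects-< u u') ×-reflects
                fallingLabels-reflects _)
    (uncurry _∷_) (λ l → Linked.head l , Linked.tail l)

fallingMaxChain⇔ : ∀ n k c → T (isMaxChain n k c ∧ fallingLabels (labels c)) ⇔
  ((T (headIs bottom c) × T (lastIs (topM n k) c) × T (coverChain n c)) × T (fallingLabels (labels c)))
fallingMaxChain⇔ n k c =
  reflects⇒T⇔ ((T-reflects _ ×-reflects T-reflects _ ×-reflects T-reflects _) ×-reflects T-reflects _)

-- Deleting a good pair keeps a lattice path matroid

head+index≤ : ∀ {u a} us → Increasing (u ∷ us) → a ∈ u ∷ us → u + index a (u ∷ us) ≤ a + 1
head+index≤ {u} {a} us iU a∈ with a ≟ u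
... | yes refl rewrite index-head a us = ≤-refl
head+index≤ {u} {a} (u' ∷ us) (u<u' ∷ iU) a∈ | no a≢u = begin
  u + index a (u ∷ u' ∷ us)   ≡⟨ cong (u +_) (index-∷ (u' ∷ us) a≢u) ⟩
  u + suc (index a (u' ∷ us)) ≡⟨ +-suc u _ ⟩
  suc u + index a (u' ∷ us)   ≤⟨ +-monoˡ-≤ _ u<u' ⟩
  u' + index a (u' ∷ us)      ≤⟨ head+index≤ us iU (Any.tail a≢u a∈) ⟩
  a + 1                       ∎
  where open ≤-Reasoning
head+index≤ [] [-] a∈ | no a≢u with () ← Any.tail a≢u a∈

-- The entry c of L facing u has already been deleted, so the tail us is compared with ls; the
-- slack a + 1 ≤ index a (u ∷ us) + c keeps every entry before a below the next entry of L.
pointwise-remove-shifted : ∀ {u c a} us ls → Increasing (u ∷ us) → Increasing (c ∷ ls) →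
  Pointwise _≤_ us ls → a ∈ u ∷ us → a + 1 ≤ index a (u ∷ us) + c →
  Pointwise _≤_ (remove a (u ∷ us)) ls
pointwise-remove-shifted {u} {c} {a} us ls iU iL pw a∈ slack with a ≟ u
... | yes refl rewrite remove-head iU = pw
pointwise-remove-shifted [] ls iU iL pw a∈ slack | no a≢u with () ← Any.tail a≢u a∈
pointwise-remove-shifted {u} {c} {a} (u' ∷ us) (l' ∷ ls) iU@(_ ∷ iU') (c<l' ∷ iL) (_ ∷ pw) a∈ slack
  | no a≢u rewrite remove-∷ {xs = u' ∷ us} (a≢u ∘ sym) =
  ≤-trans u≤c (<⇒≤ c<l') ∷ pointwise-remove-shifted us ls iU' iL pw (Any.tail a≢u a∈) slack'
  where
  j = index a (u' ∷ us)
  index≡ : index a (u ∷ u' ∷ us) ≡ suc j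
  index≡ = index-∷ (u' ∷ us) a≢u
  u≤c : u ≤ c
  u≤c = +-cancelʳ-≤ (suc j) u c (begin
    u + suc j                 ≡⟨ cong (u +_) index≡ ⟨
    u + index a (u ∷ u' ∷ us) ≤⟨ head+index≤ _ iU a∈ ⟩
    a + 1                     ≤⟨ slack ⟩
    index a (u ∷ u' ∷ us) + c ≡⟨ cong (_+ c) index≡ ⟩
    suc j + c                 ≡⟨ +-comm (suc j) c ⟩
    c + suc j                 ∎)
    where open ≤-Reasoning
  slack' : a + 1 ≤ j + l'
  slack' = begin
    a + 1                     ≤⟨ slack ⟩
    index a (u ∷ u' ∷ us) + c ≡⟨ cong (_+ c) index≡ ⟩
    suc (j + c)               ≡⟨ +-suc j c ⟨
    j + suc c                 ≤⟨ +-monoʳ-≤ j c<l' ⟩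
    j + l'                    ∎
    where open ≤-Reasoning

pointwise-remove-goodPair : ∀ U L {ℓ a} → Increasing U → Increasing L → Pointwise _≤_ U L →
                            GoodPair (U , L) ℓ a → Pointwise _≤_ (remove a U) (remove ℓ L)
pointwise-remove-goodPair (u ∷ us) (l ∷ ls) {ℓ} {a} iU iL (u≤l ∷ pw) (ℓ∈ , a∈ , i≤j , slack)
  with ℓ ≟ l
... | yes refl rewrite remove-head iL | index-head ℓ ls =
  pointwise-remove-shifted us ls iU iL pw a∈ slack
... | no ℓ≢l with a ≟ u
...   | yes refl = ⊥-elim (<⇒≱ (s≤s (index-pos (Any.tail ℓ≢l ℓ∈))) (begin
        suc (index ℓ ls)  ≡⟨ index-∷ ls ℓ≢l ⟨
        index ℓ (l ∷ ls)  ≤⟨ i≤j ⟩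
        index a (a ∷ us)  ≡⟨ index-head a us ⟩
        1                 ∎))
        where open ≤-Reasoning
...   | no a≢u rewrite remove-∷ {xs = us} (a≢u ∘ sym) | remove-∷ {xs = ls} (ℓ≢l ∘ sym)
                     | index-∷ ls ℓ≢l | index-∷ us a≢u | +-suc a (index ℓ ls) =
  u≤l ∷ pointwise-remove-goodPair us ls (Linked.tail iU) (Linked.tail iL) pw
          (Any.tail ℓ≢l ℓ∈ , Any.tail a≢u a∈ , s≤s⁻¹ i≤j , s≤s⁻¹ slack)

remove-goodPair-isLPM : ∀ {n U L ℓ u} → IsLPM n (U , L) → GoodPair (U , L) ℓ u →
                        IsLPM n (remove u U , remove ℓ L)
remove-goodPair-isLPM {U = U} {L} {ℓ} {u} (iU , iL , U⊆ , L⊆ , pw) gp =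
  minus-increasing _ iU , minus-increasing _ iL , U⊆ ∘ remove-⊆ u U , L⊆ ∘ remove-⊆ ℓ L ,
  pointwise-remove-goodPair U L iU iL pw gp

-- Covers of 𝒫ₙ are deletions of good pairs

record GoodDeletion (N M : LPM) : Set where
  field
    ℓ u     : ℕ
    U⊆      : proj₁ N ⊆ proj₁ M
    L⊆      : proj₂ N ⊆ proj₂ M
    U-minus : minus (proj₁ M) (proj₁ N) ≡ [ u ]
    L-minus : minus (proj₂ M) (proj₂ N) ≡ [ ℓ ]
    good    : GoodPair M ℓ u

removal-goodDeletion : ∀ {U L ℓ u} → Increasing U → Increasing L → GoodPair (U , L) ℓ u →
                       GoodDeletion (remove u U , remove ℓ L) (U , L)
removal-goodDeletion {U} {L} {ℓ} {u} iU iL gp@(ℓ∈ , u∈ , _) = record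
  { ℓ = ℓ ; u = u ; U⊆ = remove-⊆ u U ; L⊆ = remove-⊆ ℓ L
  ; U-minus = minus-remove-self iU u∈ ; L-minus = minus-remove-self iL ℓ∈ ; good = gp }

goodDeletion⇒<q : ∀ {N M} → GoodDeletion N M → N <q M
goodDeletion⇒<q {U' , L'} {U , L} d = (U⊆ , L⊆ , greedy) , N≢M
  where
  open GoodDeletion d
  greedy : T (greedyGood (U , L) (minus U U') (minus L L'))
  greedy rewrite U-minus | L-minus =
    Equivalence.from (reflects⇒T⇔ (greedyGood-∷-reflects U L u ℓ [] [])) (good , _)
  N≢M : (U' , L') ≢ (U , L)
  N≢M refl with () ← trans (sym L-minus) (minus-self L)

cover⇒goodDeletion : ∀ {n N M} → Cover n N M → GoodDeletion N M
cover⇒goodDeletion {n} {U' , L'} {U , L}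
  ((iU' , iL' , _) , isM@(iU , iL , _) , ((U'⊆ , L'⊆ , greedy) , N≢M) , nothing-between)
  with minus U U' in U-minus | minus L L' in L-minus | greedy
     | greedyGood-length (U , L) (minus U U') (minus L L') greedy
... | [] | [] | _ | _ =
  ⊥-elim (N≢M (×-≡,≡→≡ (increasing-⊆-antisym iU' iU U'⊆ (minus≡[]⇒⊆ U-minus) ,
                         increasing-⊆-antisym iL' iL L'⊆ (minus≡[]⇒⊆ L-minus))))
... | a ∷ [] | b ∷ [] | greedy₁ | _ = record
  { ℓ = b ; u = a ; U⊆ = U'⊆ ; L⊆ = L'⊆ ; U-minus = U-minus ; L-minus = L-minus
  ; good = proj₁ (Equivalence.to (reflects⇒T⇔ (greedyGood-∷-reflects U L a b [] [])) greedy₁) }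
... | a ∷ a' ∷ as | b ∷ b' ∷ bs | greedy₂ | _ =
  ⊥-elim (nothing-between (lose (isLPM⇒∈allLPM (remove-goodPair-isLPM isM gp)) (N<K , K<M)))
  where
  gp,rest = Equivalence.to (reflects⇒T⇔ (greedyGood-∷-reflects U L a b (a' ∷ as) (b' ∷ bs))) greedy₂
  gp = proj₁ gp,rest
  K<M = goodDeletion⇒<q (removal-goodDeletion iU iL gp)
  a∉U' : a ∉ U'
  a∉U' = proj₂ (∈-minus⁻ U U' (subst (a ∈_) (sym U-minus) (here refl)))
  b∉L' : b ∉ L'
  b∉L' = proj₂ (∈-minus⁻ L L' (subst (b ∈_) (sym L-minus) (here refl)))
  U'-minus = minus-remove-head iU U-minus
  L'-minus = minus-remove-head iL L-minus
  N<K : (U' , L') <q (remove a U , remove b L)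
  N<K = ( (λ w∈ → ∈-remove⁺ (U'⊆ w∈) λ { refl → a∉U' w∈ })
        , (λ w∈ → ∈-remove⁺ (L'⊆ w∈) λ { refl → b∉L' w∈ })
        , subst₂ (λ as bs → T (greedyGood (remove a U , remove b L) as bs))
                 (sym U'-minus) (sym L'-minus) (proj₂ gp,rest) )
      , λ { refl → case trans (sym U'-minus) (minus-self U') of λ () }

goodDeletion⇒cover : ∀ {n N M} → IsLPM n N → IsLPM n M → GoodDeletion N M → Cover n N M
goodDeletion⇒cover {n} {U' , L'} {U , L} isN@(iU' , iL' , _) isM@(iU , iL , _) d =
  isN , isM , goodDeletion⇒<q d , nothing-between
  where
  open GoodDeletion d
  nothing-between : ¬ Any (λ K → (U' , L') <q K × K <q (U , L)) (allLPM n)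
  nothing-between K-between
    with (UK , LK) , K∈ , ((U'⊆UK , L'⊆LK , greedy-NK) , N≢K) , ((UK⊆U , LK⊆L , greedy-KM) , K≢M)
         ← find K-between
    with iUK , iLK , _ ← ∈allLPM⇒isLPM {n} K∈
    with between-minus-[ u ] iU' iUK iU U'⊆UK UK⊆U U-minus
       | between-minus-[ ℓ ] iL' iLK iL L'⊆LK LK⊆L L-minus
  ... | inj₁ refl | inj₁ refl = K≢M refl
  ... | inj₂ refl | inj₂ refl = N≢K refl
  ... | inj₁ refl | inj₂ refl =
    subst₂ (λ as bs → T (greedyGood (UK , L) as bs)) (minus-self UK) L-minus greedy-KM
  ... | inj₂ refl | inj₁ refl =
    subst₂ (λ as bs → T (greedyGood (UK , LK) as bs)) (minus-self UK) L-minus greedy-NK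

label-goodDeletion : ∀ {N M} (d : GoodDeletion N M) →
                     label N M ≡ (GoodDeletion.ℓ d , GoodDeletion.u d)
label-goodDeletion {U' , L'} {U , L} d rewrite GoodDeletion.U-minus d | GoodDeletion.L-minus d = refl

coverChain-⊆-last : ∀ {n t} c → T (coverChain n c) → T (lastIs t c) →
                    All (λ M → proj₁ M ⊆ proj₁ t) c
coverChain-⊆-last {t = t} (M ∷ []) _ last =
  ⊆-reflexive (cong proj₁ (sym (Equivalence.to (reflects⇒T⇔ (eqLPM-reflects t M)) last))) ∷ []
coverChain-⊆-last {n} {t} (M ∷ M' ∷ c) chain last =
  let (_ , _ , ((U⊆U' , _) , _) , _) , chain' = Equivalence.to (coverChain-∷⇔ n M M' c) chain
      ⊆-rest = coverChain-⊆-last (M' ∷ c) chain' last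
  in ⊆-trans U⊆U' (All.head ⊆-rest) ∷ ⊆-rest

-- Lowering the upper sets along an increasing map below the identity

module Lowering {n : ℕ} {Dom : List ℕ} (f : ℕ → ℕ)
  (f-≤ : ∀ x → f x ≤ x)
  (f-mono : ∀ {x y} → x ≤ y → f x ≤ f y)
  (f-strict : ∀ {x y} → x ∈ Dom → y ∈ Dom → x < y → f x < f y)
  (f-range : ∀ {x} → x ∈ range n → f x ∈ range n)
  where

  lower : LPM → LPM
  lower (U , L) = map f U , L

  f-injective : x ∈ Dom → y ∈ Dom → f x ≡ f y → x ≡ y
  f-injective {x} {y} x∈ y∈ fx≡fy with <-cmp x y
  ... | tri< x<y _ _ = ⊥-elim (<-irrefl fx≡fy (f-strict x∈ y∈ x<y))
  ... | tri≈ _ x≡y _ = x≡y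
  ... | tri> _ _ y<x = ⊥-elim (<-irrefl (sym fx≡fy) (f-strict y∈ x∈ y<x))

  map-increasing : ∀ {U} → U ⊆ Dom → Increasing U → Increasing (map f U)
  map-increasing U⊆ [] = []
  map-increasing U⊆ [-] = [-]
  map-increasing U⊆ (x<y ∷ iU) =
    f-strict (U⊆ (here refl)) (U⊆ (there (here refl))) x<y ∷ map-increasing (U⊆ ∘ there) iU

  map-pointwise : ∀ {U L} → Pointwise _≤_ U L → Pointwise _≤_ (map f U) L
  map-pointwise [] = []
  map-pointwise (u≤l ∷ pw) = ≤-trans (f-≤ _) u≤l ∷ map-pointwise pw

  lower-isLPM : ∀ {U L} → U ⊆ Dom → IsLPM n (U , L) → IsLPM n (lower (U , L))
  lower-isLPM {U} U⊆ (iU , iL , U⊆range , L⊆range , pw) =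
    map-increasing U⊆ iU , iL , fU⊆range , L⊆range , map-pointwise pw
    where
    fU⊆range : map f U ⊆ range n
    fU⊆range w∈ with _ , x∈ , refl ← ∈-map⁻ f w∈ = f-range (U⊆range x∈)

  ≡ᵇ-map : x ∈ Dom → y ∈ Dom → (f x ≡ᵇ f y) ≡ (x ≡ᵇ y)
  ≡ᵇ-map {x} {y} x∈ y∈ =
    det (proof (f x ≟ f y)) (reflects-map (proof (x ≟ y)) (cong f) (f-injective x∈ y∈))

  index-map : ∀ {x} U → x ∈ Dom → U ⊆ Dom → index (f x) (map f U) ≡ index x U
  index-map [] x∈ U⊆ = refl
  index-map (u ∷ U) x∈ U⊆ rewrite ≡ᵇ-map x∈ (U⊆ (here refl)) | index-map U x∈ (U⊆ ∘ there) = refl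

  lower-goodPair : ∀ {U L ℓ u} → U ⊆ Dom → GoodPair (U , L) ℓ u → GoodPair (lower (U , L)) ℓ (f u)
  lower-goodPair {U} {L} {ℓ} {u} U⊆ (ℓ∈ , u∈ , i≤j , slack) =
    ℓ∈ , ∈-map⁺ f u∈ , subst (index ℓ L ≤_) (sym index≡) i≤j , (begin
      f u + index ℓ L          ≤⟨ +-monoˡ-≤ _ (f-≤ u) ⟩
      u + index ℓ L            ≤⟨ slack ⟩
      index u U + ℓ            ≡⟨ cong (_+ ℓ) index≡ ⟨
      index (f u) (map f U) + ℓ ∎)
    where
    open ≤-Reasoning
    index≡ = index-map U (U⊆ u∈) U⊆

  lower-goodDeletion : ∀ {N M} → proj₁ M ⊆ Dom → GoodDeletion N M →
                       GoodDeletion (lower N) (lower M)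
  lower-goodDeletion {U' , L'} {U , L} M⊆ d = record
    { ℓ = ℓ ; u = f u ; U⊆ = Subsetₚ.map⁺ f U⊆ ; L⊆ = L⊆
    ; U-minus = trans (minus-map f U λ x∈ y∈ → f-injective (M⊆ x∈) (M⊆ (U⊆ y∈))) (cong (map f) U-minus)
    ; L-minus = L-minus ; good = lower-goodPair M⊆ good }
    where open GoodDeletion d

  lower-cover : ∀ {N M} → proj₁ M ⊆ Dom → Cover n N M → Cover n (lower N) (lower M)
  lower-cover M⊆ cov@(isN , isM , ((N⊆M , _) , _) , _) =
    goodDeletion⇒cover (lower-isLPM (⊆-trans N⊆M M⊆) isN) (lower-isLPM M⊆ isM)
                       (lower-goodDeletion M⊆ (cover⇒goodDeletion cov))

  lower-label : ∀ {N M} → proj₁ M ⊆ Dom → Cover n N M →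
                label (lower N) (lower M) ≡ map₂ f (label N M)
  lower-label M⊆ cov =
    trans (label-goodDeletion (lower-goodDeletion M⊆ d)) (cong (map₂ f) (sym (label-goodDeletion d)))
    where d = cover⇒goodDeletion cov

  lower-coverChain : ∀ c → All (λ M → proj₁ M ⊆ Dom) c → T (coverChain n c) →
                     T (coverChain n (map lower c))
  lower-coverChain (M ∷ []) (M⊆ ∷ []) isM =
    Equivalence.from (reflects⇒T⇔ (isLPM-reflects n (lower M)))
      (lower-isLPM M⊆ (Equivalence.to (reflects⇒T⇔ (isLPM-reflects n M)) isM))
  lower-coverChain (M ∷ M' ∷ c) (_ ∷ ⊆s@(M'⊆ ∷ _)) chain =
    let cov , chain' = Equivalence.to (coverChain-∷⇔ n M M' c) chain
    in Equivalence.from (coverChain-∷⇔ n (lower M) (lower M') (map lower c))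
         (lower-cover M'⊆ cov , lower-coverChain (M' ∷ c) ⊆s chain')

  lower-labels : ∀ c → All (λ M → proj₁ M ⊆ Dom) c → T (coverChain n c) →
                 labels (map lower c) ≡ map (map₂ f) (labels c)
  lower-labels (M ∷ []) _ _ = refl
  lower-labels (M ∷ M' ∷ c) (_ ∷ ⊆s@(M'⊆ ∷ _)) chain =
    let cov , chain' = Equivalence.to (coverChain-∷⇔ n M M' c) chain
    in cong₂ _∷_ (lower-label M'⊆ cov) (lower-labels (M' ∷ c) ⊆s chain')

  lower-falling : ∀ ps → T (fallingLabels ps) → T (fallingLabels (map (map₂ f) ps))
  lower-falling ps =
    Equivalence.from (reflects⇒T⇔ (fallingLabels-reflects _)) ∘ Linkedₚ.map⁺ ∘
    Linked.map still-not-rising ∘ Equivalence.to (reflects⇒T⇔ (fallingLabels-reflects ps))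
    where
    still-not-rising : ∀ {p q} → NotRising p q → NotRising (map₂ f p) (map₂ f q)
    still-not-rising not-rising (ℓ<ℓ' , fu<fu') =
      not-rising (ℓ<ℓ' , ≰⇒> λ u'≤u → <⇒≱ fu<fu' (f-mono u'≤u))

  lower-headIs : ∀ c → T (headIs bottom c) → T (headIs bottom (map lower c))
  lower-headIs (([] , L) ∷ c) bottom-head = bottom-head

  lower-lastIs : ∀ {t} c → T (lastIs t c) → T (lastIs (lower t) (map lower c))
  lower-lastIs {t} (M ∷ []) t-last =
    Equivalence.from (reflects⇒T⇔ (eqLPM-reflects (lower t) (lower M)))
      (cong lower (Equivalence.to (reflects⇒T⇔ (eqLPM-reflects t M)) t-last))
  lower-lastIs (M ∷ M' ∷ c) t-last = lower-lastIs (M' ∷ c) t-last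

  lower-injective : ∀ {M M'} → proj₁ M ⊆ Dom → proj₁ M' ⊆ Dom → lower M ≡ lower M' → M ≡ M'
  lower-injective {U , L} {U' , L'} U⊆ U'⊆ lowers≡ =
    let fU≡fU' , L≡L' = ×-≡,≡←≡ lowers≡
    in ×-≡,≡→≡ (map-injectiveOn f f-injective (All.tabulate U⊆) (All.tabulate U'⊆) fU≡fU' , L≡L')

-- Shifting b + 1, …, a down by one

module Shift (n a b : ℕ) (1≤b : 1 ≤ b) (b≤a : b ≤ a) (a≤n : a ≤ n) where

  shift : ℕ → ℕ
  shift x with x ≤? b | x ≤? a
  ... | yes _ | _     = x
  ... | no _  | yes _ = pred x
  ... | no _  | no _  = x

  shift-below : x ≤ b → shift x ≡ x
  shift-below {x} x≤b with x ≤? b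
  ... | yes _ = refl
  ... | no x≰b = ⊥-elim (x≰b x≤b)

  shift-inside : b < x → x ≤ a → suc (shift x) ≡ x
  shift-inside {suc x} b<x x≤a with suc x ≤? b | suc x ≤? a
  ... | yes x≤b | _ = ⊥-elim (<⇒≱ b<x x≤b)
  ... | no _ | yes _ = refl
  ... | no _ | no x≰a = ⊥-elim (x≰a x≤a)

  shift-above : a < x → shift x ≡ x
  shift-above {x} a<x with x ≤? b | x ≤? a
  ... | yes _ | _ = refl
  ... | no _ | yes x≤a = ⊥-elim (<⇒≱ a<x x≤a)
  ... | no _ | no _ = refl

  data ShiftCase (x : ℕ) : Set where
    below  : x ≤ b → shift x ≡ x → ShiftCase x
    inside : b < x → x ≤ a → suc (shift x) ≡ x → ShiftCase x
    above  : a < x → shift x ≡ x → ShiftCase x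

  shift-case : ∀ x → ShiftCase x
  shift-case x with x ≤? b | x ≤? a
  ... | yes x≤b | _ = below x≤b (shift-below x≤b)
  ... | no x≰b | yes x≤a = inside (≰⇒> x≰b) x≤a (shift-inside (≰⇒> x≰b) x≤a)
  ... | no _ | no x≰a = above (≰⇒> x≰a) (shift-above (≰⇒> x≰a))

  shift-≤ : ∀ x → shift x ≤ x
  shift-≤ x with shift-case x
  ... | below _ e = ≤-reflexive e
  ... | inside _ _ e = subst (shift x ≤_) e (n≤1+n _)
  ... | above _ e = ≤-reflexive e

  ≤suc-shift : ∀ x → x ≤ suc (shift x)
  ≤suc-shift x with shift-case x
  ... | below _ e = subst (λ s → x ≤ suc s) (sym e) (n≤1+n x)
  ... | inside _ _ e = ≤-reflexive (sym e)
  ... | above _ e = subst (λ s → x ≤ suc s) (sym e) (n≤1+n x)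

  b≤shift : b ≤ x → b ≤ shift x
  b≤shift {x} b≤x with shift-case x
  ... | below _ e = subst (b ≤_) (sym e) b≤x
  ... | inside b<x _ e = s≤s⁻¹ (subst (b <_) (sym e) b<x)
  ... | above _ e = subst (b ≤_) (sym e) b≤x

  shift-strict : x ≢ b → x < y → shift x < shift y
  shift-strict {x} {y} x≢b x<y with shift-case x
  ... | inside _ _ e = s≤s⁻¹ (≤-trans (subst (_< y) (sym e) x<y) (≤suc-shift y))
  ... | above a<x e rewrite e | shift-above (<-trans a<x x<y) = x<y
  ... | below x≤b e with b <? y
  ...   | yes b<y rewrite e = <-≤-trans (≤∧≢⇒< x≤b x≢b) (b≤shift (<⇒≤ b<y))
  ...   | no b≮y rewrite e | shift-below (≮⇒≥ b≮y) = x<y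

  shift-mono : x ≤ y → shift x ≤ shift y
  shift-mono {x} {y} x≤y with x ≟ b | m≤n⇒m<n∨m≡n x≤y
  ... | yes refl | _ rewrite shift-below (≤-refl {x}) = b≤shift x≤y
  ... | no x≢b | inj₁ x<y = <⇒≤ (shift-strict x≢b x<y)
  ... | no _ | inj₂ refl = ≤-refl

  shift-range : x ∈ range n → shift x ∈ range n
  shift-range {x} x∈ = ∈-range⁺ 1≤shift (≤-trans (shift-≤ x) x≤n)
    where
    x≤n = proj₂ (∈-range⁻ x∈)
    1≤shift : 1 ≤ shift x
    1≤shift with b ≤? x
    ... | yes b≤x = ≤-trans 1≤b (b≤shift b≤x)
    ... | no b≰x = subst (1 ≤_) (sym (shift-below (<⇒≤ (≰⇒> b≰x)))) (proj₁ (∈-range⁻ x∈))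

  shift-≢a : x ≢ b → shift x ≢ a
  shift-≢a {x} x≢b shift≡a with shift-case x
  ... | below x≤b e = <⇒≢ (<-≤-trans (≤∧≢⇒< x≤b x≢b) b≤a) (trans (sym e) shift≡a)
  ... | inside _ x≤a e = <⇒≢ (subst (_≤ a) (sym e) x≤a) shift≡a
  ... | above a<x e = <⇒≢ a<x (sym (trans (sym e) shift≡a))

  shift-preimage : w ∈ range n → w ≢ a → ∃ λ x → x ∈ range n × x ≢ b × shift x ≡ w
  shift-preimage {w} w∈ w≢a with w <? b | w <? a
  ... | yes w<b | _ = w , w∈ , <⇒≢ w<b , shift-below (<⇒≤ w<b)
  ... | no w≮b | yes w<a =
    suc w , ∈-range⁺ (s≤s z≤n) (≤-trans w<a a≤n) , (λ { refl → w≮b (n<1+n w) }) ,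
    suc-injective (shift-inside (s≤s (≮⇒≥ w≮b)) w<a)
  ... | no w≮b | no w≮a =
    w , w∈ , (λ w≡b → w≢a (≤-antisym (subst (_≤ a) (sym w≡b) b≤a) (≮⇒≥ w≮a))) ,
    shift-above (≤∧≢⇒< (≮⇒≥ w≮a) (w≢a ∘ sym))

  Dom : List ℕ
  Dom = remove b (range n)

  open Lowering {n} {Dom} shift shift-≤ shift-mono
                (λ x∈ _ → shift-strict (proj₂ (∈-remove⁻ b (range n) x∈))) shift-range

  shift-top : map shift Dom ≡ remove a (range n)
  shift-top = increasing-⊆-antisym (map-increasing ⊆-refl (minus-increasing _ (range-increasing n)))
                                   (minus-increasing _ (range-increasing n)) ⊆top top⊆
    where
    ⊆top : map shift Dom ⊆ remove a (range n)
    ⊆top w∈ with x , x∈ , refl ← ∈-map⁻ shift w∈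
            with x∈range , x≢b ← ∈-remove⁻ b (range n) x∈ =
      ∈-remove⁺ (shift-range x∈range) (shift-≢a x≢b)
    top⊆ : remove a (range n) ⊆ map shift Dom
    top⊆ w∈ with w∈range , w≢a ← ∈-remove⁻ a (range n) w∈
         with x , x∈range , x≢b , refl ← shift-preimage w∈range w≢a =
      ∈-map⁺ shift (∈-remove⁺ x∈range x≢b)

  maxChain-⊆-Dom : ∀ c → T (isMaxChain n b c ∧ fallingLabels (labels c)) →
                   All (λ M → proj₁ M ⊆ Dom) c
  maxChain-⊆-Dom c fc with (_ , last , chain) , _ ← Equivalence.to (fallingMaxChain⇔ n b c) fc =
    coverChain-⊆-last c chain last

  lower-fallingMaxChain : ∀ c → T (isMaxChain n b c ∧ fallingLabels (labels c)) →
                          T (isMaxChain n a (map lower c) ∧ fallingLabels (labels (map lower c)))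
  lower-fallingMaxChain c fc
    with (head , last , chain) , falling ← Equivalence.to (fallingMaxChain⇔ n b c) fc =
    Equivalence.from (fallingMaxChain⇔ n a (map lower c))
      ( ( lower-headIs c head
        , subst (λ t → T (lastIs t (map lower c))) (cong (_, remove 1 (range n)) shift-top)
                (lower-lastIs c last)
        , lower-coverChain c c⊆Dom chain )
      , subst (T ∘ fallingLabels) (sym (lower-labels c c⊆Dom chain))
              (lower-falling (labels c) falling) )
    where
    c⊆Dom = maxChain-⊆-Dom c fc

  shiftChain : FC n b → FC n a
  shiftChain (c , fc) = map lower c , lower-fallingMaxChain c fc

  shiftChain-injective : ∀ {C C'} → shiftChain C ≡ shiftChain C' → C ≡ C'
  shiftChain-injective {c , fc} {c' , fc'} shifts≡
    with refl ← map-injectiveOn lower lower-injective (maxChain-⊆-Dom c fc) (maxChain-⊆-Dom c' fc')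
                                (cong proj₁ shifts≡) =
    cong (c ,_) (T-irrelevant fc fc')

theorem3p11 : (n : ℕ) → 2 ≤ n → (a b : ℕ) → 1 ≤ b → b ≤ a → a ≤ n →
    FC n b ↣ FC n a
theorem3p11 n _ a b 1≤b b≤a a≤n = mk↣ shiftChain-injective
  where open Shift n a b 1≤b b≤a a≤n
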